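{- Suppose $x,y\to\infty$ in such a way that $y=o(\log x)$. Then $$A(x,y)\sim \Psi(x,y),$$ i.e. $A(x,y)/\Psi(x,y)\to 1$.
   Context: For $x\ge 1$ and $y\ge 2$, let $S(x,y)=\{n\le x: P(n)\le y\}$ be the set of $y$-smooth positive integers up to $x$, where $P(n)$ is the largest prime factor of $n\ge 2$ and $P(1)=1$. Let $\Psi(x,y)=|S(x,y)|$. Define $$A(x,y)=\#\{ab:\ a,b\in S(\sqrt{x},y)\},$$ the number of distinct integers that can be written as a product of two $y$-smooth integers each at most $\sqrt{x}$. -}

module Defs where

open import Data.Nat using (ℕ; suc; _*_; _≤_; _≤?_; _≟_)
open import Data.Nat.Divisibility using (_∣_; _∣?_)
open import Data.Nat.Primality using (Prime; prime?)
open import Data.List using (List; upTo; map; filter; length; concatMap; deduplicate)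
open import Data.List.Relation.Unary.All using (All; all?)
open import Relation.Nullary.Decidable using (Dec; _→-dec_; _×-dec_)
open import Data.Product using (_×_)

-- For n ≥ 1 every prime factor lies in [0, n], so quantifying over
-- upTo (suc n) = [0 .. n] is the same as quantifying over all primes.
Smooth : ℕ → ℕ → Set
Smooth y n = All (λ p → Prime p → p ∣ n → p ≤ y) (upTo (suc n))

smooth? : (y n : ℕ) → Dec (Smooth y n)
smooth? y n = all? (λ p → prime? p →-dec ((p ∣? n) →-dec (p ≤? y))) (upTo (suc n))

pos : ℕ → List ℕ
pos x = map suc (upTo x)

S : ℕ → ℕ → List ℕ
S x y = filter (smooth? y) (pos x)

Ψ : ℕ → ℕ → ℕ
Ψ x y = length (S x y)

-- S(√x, y) = { a ≥ 1 : a ≤ √x, P(a) ≤ y } = { a ≥ 1 : a * a ≤ x, P(a) ≤ y }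
Shalf : ℕ → ℕ → List ℕ
Shalf x y = filter (λ a → (a * a ≤? x) ×-dec smooth? y a) (pos x)

A : ℕ → ℕ → ℕ
A x y = length (deduplicate _≟_ (concatMap (λ a → map (a *_) (Shalf x y)) (Shalf x y)))

-- Every product a b counted by A(x, y) is a y-smooth number up to x, so A ≤ Ψ.
-- Conversely a y-smooth n with n y ≤ x splits greedily as n = a b with
-- a ≤ b ≤ a y, so a, b ≤ √x; hence Ψ - A is at most the number L of y-smooth n
-- in (x / y, x].  For those n, x ^ L ≤ ∏ (n y).  Counting prime by prime, the
-- geometric progression m, m p, m p², … meets (x / y, x] at most 1 + log_p y times,
-- so ∏ n ≤ (y²) ^ (π(y) Ψ), and Chebyshev's bound y ^ π(y) ≤ 2 ^ (8 y) turns this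
-- into x ^ L ≤ 2 ^ (16 y Ψ + y L).  If 2 ^ (K y) ≤ x with K = 16 (m + 1) + 1,
-- comparing exponents gives (m + 1) L ≤ Ψ.
module Submission where

open import Defs
open import Algebra.Bundles using (CommutativeMonoid)
open import Data.List using (List; []; _∷_; _++_; [_]; map; filter; length; upTo; concatMap; deduplicate)
open import Data.List.Properties using (length-++; map-++; filter-++; upTo-∷ʳ)
open import Data.List.Membership.Propositional using (_∈_; find)
open import Data.List.Membership.Propositional.Properties
open import Data.List.Relation.Binary.Subset.Propositional using (_⊆_)
open import Data.List.Relation.Unary.All as All using (All; []; _∷_)
open import Data.List.Relation.Unary.Any as Any using (here; there)
open import Data.List.Relation.Unary.AllPairs using (_∷_)
open import Data.List.Relation.Unary.Unique.Propositional using (Unique)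
import Data.List.Relation.Unary.Unique.Propositional.Properties as Unique
import Data.List.Relation.Unary.Unique.DecPropositional.Properties as UniqueDec
open import Data.Nat
open import Data.Nat.Divisibility
open import Data.Nat.Induction using (<-rec)
open import Data.Nat.ListAction using (product)
open import Data.Nat.ListAction.Properties using (∈⇒∣product)
open import Data.Nat.Primality
open import Data.Nat.Coprimality using (Coprime; coprime-divisor)
open import Data.Nat.Solver using (module +-*-Solver)
open import Data.Nat.Primality.Factorisation using (factorise)
open import Data.Nat.Properties
open import Algebra.Properties.CommutativeSemigroup *-commutativeSemigroup
   using (x∙yz≈y∙xz; xy∙z≈xz∙y) renaming (interchange to *-interchange)
open import Data.Product using (_×_; _,_; proj₁; proj₂; ∃₂; ∃-syntax)
open import Data.Sum using (_⊎_; inj₁; inj₂)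
open import Relation.Nullary using (Dec; yes; no; ¬_; contradiction)
open import Relation.Nullary.Decidable using (_×-dec_)
open import Relation.Unary using (Decidable)
open import Relation.Binary.PropositionalEquality
  using (_≡_; refl; sym; trans; cong; cong₂; subst; subst₂; module ≡-Reasoning)

-- Sums and products over 1 … n

1≤_≤_ : ℕ → ℕ → Set
1≤ i ≤ n = 1 ≤ i × i ≤ n

1≤-≤-suc : ∀ {i n} → 1≤ i ≤ n → 1≤ i ≤ suc n
1≤-≤-suc (1≤i , i≤n) = 1≤i , m≤n⇒m≤1+n i≤n

1≤suc≤suc : ∀ n → 1≤ suc n ≤ suc n
1≤suc≤suc n = s≤s z≤n , ≤-refl

module BigOperator {c ℓ} (M : CommutativeMonoid c ℓ) where

  open CommutativeMonoid M renaming (refl to ≈-refl; sym to ≈-sym; trans to ≈-trans)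
  open import Algebra.Properties.CommutativeSemigroup commutativeSemigroup using (interchange)
  open import Relation.Binary.Reasoning.Setoid setoid

  ⨁ : ℕ → (ℕ → Carrier) → Carrier
  ⨁ zero    f = ε
  ⨁ (suc n) f = ⨁ n f ∙ f (suc n)

  ⨁-cong : ∀ n {f g} → (∀ i → 1≤ i ≤ n → f i ≈ g i) → ⨁ n f ≈ ⨁ n g
  ⨁-cong zero    f≈g = ≈-refl
  ⨁-cong (suc n) f≈g = ∙-cong (⨁-cong n (λ i r → f≈g i (1≤-≤-suc r))) (f≈g (suc n) (1≤suc≤suc n))

  ⨁-ε : ∀ n {f} → (∀ i → 1≤ i ≤ n → f i ≈ ε) → ⨁ n f ≈ ε
  ⨁-ε zero    f≈ε = ≈-refl
  ⨁-ε (suc n) f≈ε = ≈-trans (∙-cong (⨁-ε n (λ i r → f≈ε i (1≤-≤-suc r))) (f≈ε (suc n) (1≤suc≤suc n))) (identityˡ ε)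

  ⨁-distrib : ∀ n f g → ⨁ n (λ i → f i ∙ g i) ≈ ⨁ n f ∙ ⨁ n g
  ⨁-distrib zero    f g = ≈-sym (identityˡ ε)
  ⨁-distrib (suc n) f g = begin
    ⨁ n (λ i → f i ∙ g i) ∙ (f (suc n) ∙ g (suc n)) ≈⟨ ∙-congʳ (⨁-distrib n f g) ⟩
    (⨁ n f ∙ ⨁ n g) ∙ (f (suc n) ∙ g (suc n))       ≈⟨ interchange _ _ _ _ ⟩
    (⨁ n f ∙ f (suc n)) ∙ (⨁ n g ∙ g (suc n))       ∎

  ⨁-comm : ∀ n m (h : ℕ → ℕ → Carrier) → ⨁ n (λ i → ⨁ m (h i)) ≈ ⨁ m (λ j → ⨁ n (λ i → h i j))
  ⨁-comm zero    m h = ≈-sym (⨁-ε m (λ _ _ → ≈-refl))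
  ⨁-comm (suc n) m h = ≈-trans (∙-congʳ (⨁-comm n m h)) (≈-sym (⨁-distrib m (λ j → ⨁ n (λ i → h i j)) (h (suc n))))

  ⨁-split : ∀ a b f → ⨁ (a + b) f ≈ ⨁ a f ∙ ⨁ b (λ i → f (a + i))
  ⨁-split a zero    f = begin
    ⨁ (a + 0) f ≡⟨ cong (λ k → ⨁ k f) (+-identityʳ a) ⟩
    ⨁ a f       ≈⟨ identityʳ (⨁ a f) ⟨
    ⨁ a f ∙ ε   ∎
  ⨁-split a (suc b) f = begin
    ⨁ (a + suc b) f                                    ≡⟨ cong (λ k → ⨁ k f) (+-suc a b) ⟩
    ⨁ (a + b) f ∙ f (suc (a + b))                      ≈⟨ ∙-cong (⨁-split a b f) (reflexive (cong f (sym (+-suc a b)))) ⟩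
    (⨁ a f ∙ ⨁ b (λ i → f (a + i))) ∙ f (a + suc b)   ≈⟨ assoc _ _ _ ⟩
    ⨁ a f ∙ ⨁ (suc b) (λ i → f (a + i))                ∎

open BigOperator +-0-commutativeMonoid
  renaming (⨁ to ∑; ⨁-cong to ∑-cong; ⨁-ε to ∑-zero; ⨁-distrib to ∑-distrib; ⨁-comm to ∑-comm; ⨁-split to ∑-split)
open BigOperator *-1-commutativeMonoid
  renaming (⨁ to ∏; ⨁-cong to ∏-cong; ⨁-ε to ∏-one; ⨁-distrib to ∏-distrib; ⨁-comm to ∏-comm; ⨁-split to ∏-split)

∑-mono-≤ : ∀ n {f g} → (∀ i → 1≤ i ≤ n → f i ≤ g i) → ∑ n f ≤ ∑ n g
∑-mono-≤ zero    f≤g = z≤n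
∑-mono-≤ (suc n) f≤g = +-mono-≤ (∑-mono-≤ n (λ i r → f≤g i (1≤-≤-suc r))) (f≤g (suc n) (1≤suc≤suc n))

∏-mono-≤ : ∀ n {f g} → (∀ i → 1≤ i ≤ n → f i ≤ g i) → ∏ n f ≤ ∏ n g
∏-mono-≤ zero    f≤g = ≤-refl
∏-mono-≤ (suc n) f≤g = *-mono-≤ (∏-mono-≤ n (λ i r → f≤g i (1≤-≤-suc r))) (f≤g (suc n) (1≤suc≤suc n))

∑-monoˡ-≤ : ∀ f {a b} → a ≤ b → ∑ a f ≤ ∑ b f
∑-monoˡ-≤ f {a} a≤b with k , refl ← m≤n⇒∃[o]m+o≡n a≤b =
  subst (∑ a f ≤_) (sym (∑-split a k f)) (m≤m+n _ _)

*-distribˡ-∑ : ∀ c n f → c * ∑ n f ≡ ∑ n (λ i → c * f i)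
*-distribˡ-∑ c zero    f = *-zeroʳ c
*-distribˡ-∑ c (suc n) f = trans (*-distribˡ-+ c (∑ n f) (f (suc n))) (cong (_+ c * f (suc n)) (*-distribˡ-∑ c n f))

∏-^ : ∀ c n f → ∏ n (λ i → c ^ f i) ≡ c ^ ∑ n f
∏-^ c zero    f = refl
∏-^ c (suc n) f = trans (cong (_* c ^ f (suc n)) (∏-^ c n f)) (sym (^-distribˡ-+-* c (∑ n f) (f (suc n))))

-- Counting with indicators

𝟙 : {P : Set} → Dec P → ℕ
𝟙 (yes _) = 1
𝟙 (no _)  = 0

𝟙-yes : {P : Set} (d : Dec P) → P → 𝟙 d ≡ 1
𝟙-yes (yes _) _ = refl
𝟙-yes (no ¬p) p = contradiction p ¬p

𝟙-no : {P : Set} (d : Dec P) → ¬ P → 𝟙 d ≡ 0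
𝟙-no (yes p) ¬p = contradiction p ¬p
𝟙-no (no _)  _  = refl

𝟙-mono : {P Q : Set} (d : Dec P) (e : Dec Q) → (P → Q) → 𝟙 d ≤ 𝟙 e
𝟙-mono (yes p) e P⇒Q = ≤-reflexive (sym (𝟙-yes e (P⇒Q p)))
𝟙-mono (no _)  e P⇒Q = z≤n

𝟙-⊎ : {P Q R : Set} (d : Dec P) (e : Dec Q) (f : Dec R) → (P → Q ⊎ R) → 𝟙 d ≤ 𝟙 e + 𝟙 f
𝟙-⊎ (no _)  e f P⇒Q⊎R = z≤n
𝟙-⊎ (yes p) e f P⇒Q⊎R with P⇒Q⊎R p
... | inj₁ q = ≤-trans (≤-reflexive (sym (𝟙-yes e q))) (m≤m+n _ _)
... | inj₂ r = ≤-trans (≤-reflexive (sym (𝟙-yes f r))) (m≤n+m _ _)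

length-filter-pos : {P : ℕ → Set} (P? : Decidable P) (x : ℕ) →
                    length (filter P? (pos x)) ≡ ∑ x (λ n → 𝟙 (P? n))
length-filter-pos P? zero    = refl
length-filter-pos P? (suc x) = begin
  length (filter P? (map suc (upTo (suc x))))               ≡⟨ cong (λ l → length (filter P? (map suc l))) (upTo-∷ʳ x) ⟨
  length (filter P? (map suc (upTo x ++ [ x ])))            ≡⟨ cong (λ l → length (filter P? l)) (map-++ suc (upTo x) [ x ]) ⟩
  length (filter P? (pos x ++ [ suc x ]))                   ≡⟨ cong length (filter-++ P? (pos x) [ suc x ]) ⟩
  length (filter P? (pos x) ++ filter P? [ suc x ])         ≡⟨ length-++ (filter P? (pos x)) ⟩
  length (filter P? (pos x)) + length (filter P? [ suc x ]) ≡⟨ cong₂ _+_ (length-filter-pos P? x) (length-filter-[] (suc x)) ⟩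
  ∑ (suc x) (λ n → 𝟙 (P? n))                                ∎
  where
  open ≡-Reasoning
  length-filter-[] : ∀ a → length (filter P? [ a ]) ≡ 𝟙 (P? a)
  length-filter-[] a with P? a
  ... | yes _ = refl
  ... | no _  = refl

∑-multiples-block : ∀ d k (g : ℕ → ℕ) → 1 ≤ d →
  ∑ d (λ i → 𝟙 (d ∣? (k * d + i)) * g (k * d + i)) ≡ g (suc k * d)
∑-multiples-block (suc d) k g _ = begin
  ∑ d F + F (suc d)                                     ≡⟨ cong (_+ F (suc d)) (∑-zero d non-multiple) ⟩
  F (suc d)                                             ≡⟨ cong (λ t → 𝟙 (suc d ∣? t) * g t) (+-comm (k * suc d) (suc d)) ⟩
  𝟙 (suc d ∣? (suc k * suc d)) * g (suc k * suc d)      ≡⟨ cong (_* g (suc k * suc d)) (𝟙-yes (suc d ∣? _) (n∣m*n (suc k))) ⟩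
  1 * g (suc k * suc d)                                 ≡⟨ *-identityˡ _ ⟩
  g (suc k * suc d)                                     ∎
  where
  open ≡-Reasoning
  F : ℕ → ℕ
  F i = 𝟙 (suc d ∣? (k * suc d + i)) * g (k * suc d + i)
  non-multiple : ∀ i → 1≤ i ≤ d → F i ≡ 0
  non-multiple i (1≤i , i≤d) = cong (_* g (k * suc d + i)) (𝟙-no (suc d ∣? _) λ d+1∣ →
    <⇒≱ (s≤s i≤d) (∣⇒≤ {{>-nonZero 1≤i}} (∣m+n∣m⇒∣n d+1∣ (n∣m*n k))))

∑-multiples : ∀ d k (g : ℕ → ℕ) → 1 ≤ d → ∑ (k * d) (λ n → 𝟙 (d ∣? n) * g n) ≡ ∑ k (λ m → g (m * d))
∑-multiples d zero    g _   = refl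
∑-multiples d (suc k) g 1≤d = begin
  ∑ (d + k * d) F                            ≡⟨ cong (λ t → ∑ t F) (+-comm d (k * d)) ⟩
  ∑ (k * d + d) F                            ≡⟨ ∑-split (k * d) d F ⟩
  ∑ (k * d) F + ∑ d (λ i → F (k * d + i))    ≡⟨ cong₂ _+_ (∑-multiples d k g 1≤d) (∑-multiples-block d k g 1≤d) ⟩
  ∑ k (λ m → g (m * d)) + g (suc k * d)      ∎
  where
  open ≡-Reasoning
  F : ℕ → ℕ
  F n = 𝟙 (d ∣? n) * g n

∑-multiples-≤ : ∀ d x (g : ℕ → ℕ) → 1 ≤ d → ∑ x (λ n → 𝟙 (d ∣? n) * g n) ≤ ∑ x (λ m → g (m * d))
∑-multiples-≤ d x g 1≤d = ≤-trans (∑-monoˡ-≤ (λ n → 𝟙 (d ∣? n) * g n) (m≤m*n x d {{>-nonZero 1≤d}}))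
                                  (≤-reflexive (∑-multiples d x g 1≤d))

unique⊆⇒length≤ : {xs ys : List ℕ} → Unique xs → xs ⊆ ys → length xs ≤ length ys
unique⊆⇒length≤ {[]}     _            _   = z≤n
unique⊆⇒length≤ {a ∷ xs} (a∉xs ∷ !xs) sub with us , vs , refl ← ∈-∃++ (sub (here refl)) =
  subst (suc (length xs) ≤_) (sym (trans (length-++ us) (+-suc (length us) (length vs))))
    (s≤s (subst (length xs ≤_) (length-++ us) (unique⊆⇒length≤ !xs xs⊆us++vs)))
  where
  xs⊆us++vs : xs ⊆ us ++ vs
  xs⊆us++vs {z} z∈xs with ∈-++⁻ us (sub (there z∈xs))
  ... | inj₁ z∈us         = ∈-++⁺ˡ z∈us
  ... | inj₂ (here refl)  = contradiction refl (All.lookup a∉xs z∈xs)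
  ... | inj₂ (there z∈vs) = ∈-++⁺ʳ us z∈vs

pos-unique : ∀ x → Unique (pos x)
pos-unique x = Unique.map⁺ suc-injective (Unique.upTo⁺ x)

∈-pos⁺ : ∀ {x n} → 1 ≤ n → n ≤ x → n ∈ pos x
∈-pos⁺ {n = suc n} _ n≤x = ∈-map⁺ suc (∈-upTo⁺ n≤x)

∈-pos⁻ : ∀ {x n} → n ∈ pos x → 1≤ n ≤ x
∈-pos⁻ n∈ with k , k∈ , refl ← ∈-map⁻ suc n∈ = s≤s z≤n , ∈-upTo⁻ k∈

-- Smooth numbers

AllPrimeFactors≤ : ℕ → ℕ → Set
AllPrimeFactors≤ y n = ∀ p → Prime p → p ∣ n → p ≤ y

allPrimeFactors≤⇒smooth : ∀ {y n} → AllPrimeFactors≤ y n → Smooth y n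
allPrimeFactors≤⇒smooth h = All.tabulate (λ {p} _ → h p)

smooth⇒allPrimeFactors≤ : ∀ {y n} → 1 ≤ n → Smooth y n → AllPrimeFactors≤ y n
smooth⇒allPrimeFactors≤ {n = suc n} _ s p p-prime p∣n =
  All.lookup s (∈-upTo⁺ (s≤s (∣⇒≤ p∣n))) p-prime p∣n

allPrimeFactors≤-∣ : ∀ {y a n} → a ∣ n → AllPrimeFactors≤ y n → AllPrimeFactors≤ y a
allPrimeFactors≤-∣ a∣n h p p-prime p∣a = h p p-prime (∣-trans p∣a a∣n)

allPrimeFactors≤-* : ∀ {y a b} → AllPrimeFactors≤ y a → AllPrimeFactors≤ y b → AllPrimeFactors≤ y (a * b)
allPrimeFactors≤-* {a = a} {b} ha hb p p-prime p∣ab with euclidsLemma a b p-prime p∣ab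
... | inj₁ p∣a = ha p p-prime p∣a
... | inj₂ p∣b = hb p p-prime p∣b

smooth-∣ : ∀ {y a n} → 1 ≤ n → a ∣ n → Smooth y n → Smooth y a
smooth-∣ 1≤n a∣n s = allPrimeFactors≤⇒smooth (allPrimeFactors≤-∣ a∣n (smooth⇒allPrimeFactors≤ 1≤n s))

prime⇒2≤ : ∀ {p} → Prime p → 2 ≤ p
prime⇒2≤ {p} p-prime = nonTrivial⇒n>1 p {{prime⇒nonTrivial p-prime}}

prime⇒1≤ : ∀ {p} → Prime p → 1 ≤ p
prime⇒1≤ p-prime = ≤-trans (s≤s z≤n) (prime⇒2≤ p-prime)

smoothFactorisation : ∀ {y} n → 1 ≤ n → AllPrimeFactors≤ y n →
  ∃[ ps ] product ps ≡ n × All (λ p → Prime p × p ≤ y) ps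
smoothFactorisation n@(suc _) _ h with factorise n
... | record { factors = ps ; isFactorisation = ps≡n ; factorsPrime = ps-prime } =
  ps , sym ps≡n , All.tabulate (λ {p} p∈ps → All.lookup ps-prime p∈ps ,
    h p (All.lookup ps-prime p∈ps) (subst (p ∣_) (sym ps≡n) (∈⇒∣product p∈ps)))

-- Products of two smooth numbers up to √x

-- Greedy balancing: each new factor q ≤ y goes into the smaller part a; if a * q
-- overtakes b the parts swap, and b ≤ a * q ≤ b * y keeps the invariant.
balancedSplit : ∀ {y} → 1 ≤ y → (qs : List ℕ) → All (λ q → 1≤ q ≤ y) qs →
  ∃₂ λ a b → a * b ≡ product qs × 1 ≤ a × a ≤ b × b ≤ a * y
balancedSplit {y} 1≤y [] [] = 1 , 1 , refl , ≤-refl , ≤-refl , subst (1 ≤_) (sym (+-identityʳ y)) 1≤y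
balancedSplit {y} 1≤y (q ∷ qs) ((1≤q , q≤y) ∷ qs≤y)
  with a , b , ab≡ , 1≤a , a≤b , b≤ay ← balancedSplit 1≤y qs qs≤y
  with a * q ≤? b
... | yes aq≤b = a * q , b , product-eq , *-mono-≤ 1≤a 1≤q , aq≤b ,
                 ≤-trans b≤ay (*-monoˡ-≤ y (m≤m*n a q {{>-nonZero 1≤q}}))
  where
  open ≡-Reasoning
  product-eq : a * q * b ≡ q * product qs
  product-eq = begin
    a * q * b   ≡⟨ cong (_* b) (*-comm a q) ⟩
    q * a * b   ≡⟨ *-assoc q a b ⟩
    q * (a * b) ≡⟨ cong (q *_) ab≡ ⟩
    q * product qs ∎
... | no aq≰b = b , a * q , product-eq , ≤-trans 1≤a a≤b , <⇒≤ (≰⇒> aq≰b) , *-mono-≤ a≤b q≤y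
  where
  open ≡-Reasoning
  product-eq : b * (a * q) ≡ q * product qs
  product-eq = begin
    b * (a * q) ≡⟨ cong (b *_) (*-comm a q) ⟩
    b * (q * a) ≡⟨ x∙yz≈y∙xz b q a ⟩
    q * (b * a) ≡⟨ cong (q *_) (trans (*-comm b a) ab≡) ⟩
    q * product qs ∎

balancedFactorisation : ∀ {x y n} → 1 ≤ y → 1 ≤ n → AllPrimeFactors≤ y n → n * y ≤ x →
  ∃₂ λ a b → a * b ≡ n × 1 ≤ a × 1 ≤ b × a * a ≤ x × b * b ≤ x
balancedFactorisation {x} {y} {n} 1≤y 1≤n h ny≤x
  with ps , ps≡n , ps≤y ← smoothFactorisation n 1≤n h
  with a , b , ab≡ , 1≤a , a≤b , b≤ay ←
       balancedSplit 1≤y ps (All.map (λ (p-prime , p≤y) → prime⇒1≤ p-prime , p≤y) ps≤y) =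
  a , b , ab≡n , 1≤a , ≤-trans 1≤a a≤b , aa≤x , bb≤x
  where
  instance
    _ : NonZero y
    _ = >-nonZero 1≤y
  ab≡n : a * b ≡ n
  ab≡n = trans ab≡ ps≡n
  open ≤-Reasoning
  aa≤x : a * a ≤ x
  aa≤x = begin
    a * a ≤⟨ *-monoʳ-≤ a a≤b ⟩
    a * b ≡⟨ ab≡n ⟩
    n     ≤⟨ m≤m*n n y ⟩
    n * y ≤⟨ ny≤x ⟩
    x     ∎
  bb≤x : b * b ≤ x
  bb≤x = begin
    b * b       ≤⟨ *-monoʳ-≤ b b≤ay ⟩
    b * (a * y) ≡⟨ *-assoc b a y ⟨
    b * a * y   ≡⟨ cong (_* y) (trans (*-comm b a) ab≡n) ⟩
    n * y       ≤⟨ ny≤x ⟩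
    x           ∎

products : ℕ → ℕ → List ℕ
products x y = concatMap (λ a → map (a *_) (Shalf x y)) (Shalf x y)

∈-Shalf⁺ : ∀ {x y a} → 1 ≤ a → a * a ≤ x → Smooth y a → a ∈ Shalf x y
∈-Shalf⁺ {x} {y} {a} 1≤a aa≤x s =
  ∈-filter⁺ (λ a → (a * a ≤? x) ×-dec smooth? y a)
    (∈-pos⁺ 1≤a (≤-trans (m≤m*n a a {{>-nonZero 1≤a}}) aa≤x)) (aa≤x , s)

∈-Shalf⁻ : ∀ {x y a} → a ∈ Shalf x y → 1 ≤ a × a * a ≤ x × Smooth y a
∈-Shalf⁻ {x} {y} a∈ with a∈pos , aa≤x , s ← ∈-filter⁻ (λ a → (a * a ≤? x) ×-dec smooth? y a) {xs = pos x} a∈ =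
  proj₁ (∈-pos⁻ a∈pos) , aa≤x , s

∈-products⁺ : ∀ {x y a b} → a ∈ Shalf x y → b ∈ Shalf x y → a * b ∈ deduplicate _≟_ (products x y)
∈-products⁺ {x} {y} {a} a∈ b∈ =
  ∈-deduplicate⁺ _≟_ (∈-concatMap⁺ (λ a → map (a *_) (Shalf x y)) (Any.map (λ { refl → ∈-map⁺ (a *_) b∈ }) a∈))

∈-products⁻ : ∀ {x y z} → z ∈ deduplicate _≟_ (products x y) →
  ∃₂ λ a b → a ∈ Shalf x y × b ∈ Shalf x y × z ≡ a * b
∈-products⁻ {x} {y} z∈
  with a , a∈ , z∈aS ← find (∈-concatMap⁻ (λ a → map (a *_) (Shalf x y)) {xs = Shalf x y}
                              (∈-deduplicate⁻ _≟_ (products x y) z∈))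
  with b , b∈ , z≡ab ← ∈-map⁻ (a *_) z∈aS = a , b , a∈ , b∈ , z≡ab

*-≤-of-squares : ∀ {x} a b → a * a ≤ x → b * b ≤ x → a * b ≤ x
*-≤-of-squares a b aa≤x bb≤x with ≤-total a b
... | inj₁ a≤b = ≤-trans (*-monoˡ-≤ b a≤b) bb≤x
... | inj₂ b≤a = ≤-trans (*-monoʳ-≤ a b≤a) aa≤x

A≤Ψ : ∀ x y → A x y ≤ Ψ x y
A≤Ψ x y = unique⊆⇒length≤ (UniqueDec.deduplicate-! _≟_ (products x y)) products⊆S
  where
  products⊆S : deduplicate _≟_ (products x y) ⊆ S x y
  products⊆S z∈ with a , b , a∈ , b∈ , refl ← ∈-products⁻ {x} {y} z∈
                 with 1≤a , aa≤x , sa ← ∈-Shalf⁻ {x} {y} a∈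
                 with 1≤b , bb≤x , sb ← ∈-Shalf⁻ {x} {y} b∈ =
    ∈-filter⁺ (smooth? y) (∈-pos⁺ (*-mono-≤ 1≤a 1≤b) (*-≤-of-squares a b aa≤x bb≤x))
      (allPrimeFactors≤⇒smooth (allPrimeFactors≤-* (smooth⇒allPrimeFactors≤ 1≤a sa) (smooth⇒allPrimeFactors≤ 1≤b sb)))

smallSmooth? : ∀ x y → Decidable (λ n → Smooth y n × n * y ≤ x)
smallSmooth? x y n = smooth? y n ×-dec (n * y ≤? x)

#smallSmooth≤A : ∀ x y → 1 ≤ y → ∑ x (λ n → 𝟙 (smallSmooth? x y n)) ≤ A x y
#smallSmooth≤A x y 1≤y = subst (_≤ A x y) (length-filter-pos (smallSmooth? x y) x)
  (unique⊆⇒length≤ (Unique.filter⁺ (smallSmooth? x y) (pos-unique x)) smallSmooth⊆products)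
  where
  smallSmooth⊆products : filter (smallSmooth? x y) (pos x) ⊆ deduplicate _≟_ (products x y)
  smallSmooth⊆products n∈
    with n∈pos , sn , ny≤x ← ∈-filter⁻ (smallSmooth? x y) {xs = pos x} n∈
    with 1≤n , _ ← ∈-pos⁻ n∈pos
    with a , b , refl , 1≤a , 1≤b , aa≤x , bb≤x ←
         balancedFactorisation 1≤y 1≤n (smooth⇒allPrimeFactors≤ 1≤n sn) ny≤x =
    ∈-products⁺ {x} {y} (∈-Shalf⁺ 1≤a aa≤x (smooth-∣ 1≤n (m∣m*n b) sn))
                        (∈-Shalf⁺ 1≤b bb≤x (smooth-∣ 1≤n (n∣m*n a) sn))

InWindow : ℕ → ℕ → ℕ → Set
InWindow x y n = n ≤ x × x < n * y

inWindow? : ∀ x y → Decidable (InWindow x y)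
inWindow? x y n = (n ≤? x) ×-dec (x <? n * y)

Layer : ℕ → ℕ → ℕ → Set
Layer x y n = Smooth y n × InWindow x y n

layer? : ∀ x y → Decidable (Layer x y)
layer? x y n = smooth? y n ×-dec inWindow? x y n

#layer : ℕ → ℕ → ℕ
#layer x y = ∑ x (λ n → 𝟙 (layer? x y n))

Ψ≡∑smooth : ∀ x y → Ψ x y ≡ ∑ x (λ m → 𝟙 (smooth? y m))
Ψ≡∑smooth x y = length-filter-pos (smooth? y) x

Ψ≤A+#layer : ∀ x y → 1 ≤ y → Ψ x y ≤ A x y + #layer x y
Ψ≤A+#layer x y 1≤y = begin
  Ψ x y                                                         ≡⟨ Ψ≡∑smooth x y ⟩
  ∑ x (λ n → 𝟙 (smooth? y n))                                   ≤⟨ ∑-mono-≤ x small-or-layer ⟩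
  ∑ x (λ n → 𝟙 (smallSmooth? x y n) + 𝟙 (layer? x y n))          ≡⟨ ∑-distrib x _ _ ⟩
  ∑ x (λ n → 𝟙 (smallSmooth? x y n)) + #layer x y               ≤⟨ +-monoˡ-≤ (#layer x y) (#smallSmooth≤A x y 1≤y) ⟩
  A x y + #layer x y                                            ∎
  where
  open ≤-Reasoning
  small-or-layer : ∀ n → 1≤ n ≤ x → 𝟙 (smooth? y n) ≤ 𝟙 (smallSmooth? x y n) + 𝟙 (layer? x y n)
  small-or-layer n (_ , n≤x) = 𝟙-⊎ (smooth? y n) (smallSmooth? x y n) (layer? x y n) split
    where
    split : Smooth y n → (Smooth y n × n * y ≤ x) ⊎ Layer x y n
    split sn with n * y ≤? x
    ... | yes ny≤x = inj₁ (sn , ny≤x)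
    ... | no ny≰x  = inj₂ (sn , n≤x , ≰⇒> ny≰x)

-- Chebyshev's bound y ^ π(y) ≤ 2 ^ (8 * y)

-- pascal a b is the binomial coefficient (a + b) choose a.
pascal : ℕ → ℕ → ℕ
pascal zero    b       = 1
pascal (suc a) zero    = 1
pascal (suc a) (suc b) = pascal a (suc b) + pascal (suc a) b

pascal≥1 : ∀ a b → 1 ≤ pascal a b
pascal≥1 zero    b       = ≤-refl
pascal≥1 (suc a) zero    = ≤-refl
pascal≥1 (suc a) (suc b) = ≤-trans (pascal≥1 a (suc b)) (m≤m+n _ _)

pascal≤2^ : ∀ a b → pascal a b ≤ 2 ^ (a + b)
pascal≤2^ zero    b       = m^n>0 2 b
pascal≤2^ (suc a) zero    = m^n>0 2 (suc a + 0)
pascal≤2^ (suc a) (suc b) = begin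
  pascal a (suc b) + pascal (suc a) b ≤⟨ +-mono-≤ (pascal≤2^ a (suc b)) (pascal≤2^ (suc a) b) ⟩
  2 ^ (a + suc b) + 2 ^ (suc a + b)   ≡⟨ cong (λ t → 2 ^ t + 2 ^ (suc a + b)) (+-suc a b) ⟩
  2 ^ (suc a + b) + 2 ^ (suc a + b)   ≡⟨ cong (2 ^ (suc a + b) +_) (+-identityʳ _) ⟨
  2 ^ suc (suc a + b)                 ≡⟨ cong (2 ^_) (+-suc (suc a) b) ⟨
  2 ^ (suc a + suc b)                 ∎
  where open ≤-Reasoning

pascal-factorials : ∀ a b → a ! * b ! * pascal a b ≡ (a + b) !
pascal-factorials zero    b = trans (*-identityʳ _) (+-identityʳ _)
pascal-factorials (suc a) zero = trans (*-identityʳ _) (trans (*-identityʳ _) (cong _! (sym (+-identityʳ (suc a)))))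
pascal-factorials (suc a) (suc b) = begin
  suc a ! * suc b ! * (pascal a (suc b) + pascal (suc a) b)
    ≡⟨ regroup (suc a) (suc b) (a !) (b !) (pascal a (suc b)) (pascal (suc a) b) ⟩
  suc a * (a ! * suc b ! * pascal a (suc b)) + suc b * (suc a ! * b ! * pascal (suc a) b)
    ≡⟨ cong₂ (λ u v → suc a * u + suc b * v) (pascal-factorials a (suc b)) (pascal-factorials (suc a) b) ⟩
  suc a * (a + suc b) ! + suc b * (suc a + b) !
    ≡⟨ cong (λ t → suc a * t ! + suc b * (suc a + b) !) (+-suc a b) ⟩
  suc a * (suc a + b) ! + suc b * (suc a + b) !
    ≡⟨ *-distribʳ-+ ((suc a + b) !) (suc a) (suc b) ⟨
  (suc a + suc b) * (suc a + b) !
    ≡⟨ cong (λ t → t * (suc a + b) !) (+-suc (suc a) b) ⟩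
  suc (suc a + b) !
    ≡⟨ cong _! (+-suc (suc a) b) ⟨
  (suc a + suc b) ! ∎
  where
  open ≡-Reasoning
  open +-*-Solver
  regroup : ∀ a′ b′ fa fb u v →
    (a′ * fa) * (b′ * fb) * (u + v) ≡ a′ * (fa * (b′ * fb) * u) + b′ * ((a′ * fa) * fb * v)
  regroup = solve 6 (λ a′ b′ fa fb u v → (a′ :* fa) :* (b′ :* fb) :* (u :+ v)
                      := a′ :* (fa :* (b′ :* fb) :* u) :+ b′ :* ((a′ :* fa) :* fb :* v)) refl

∣n! : ∀ {q n} → 1 ≤ q → q ≤ n → q ∣ n !
∣n! {suc q} _ q≤n = ∣-trans (m∣m*n (q !)) (m≤n⇒m!∣n! q≤n)

prime∣n!⇒≤ : ∀ {q} n → Prime q → q ∣ n ! → q ≤ n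
prime∣n!⇒≤ zero    q-prime q∣1 = contradiction (∣⇒≤ q∣1) (<⇒≱ (prime⇒2≤ q-prime))
prime∣n!⇒≤ (suc n) q-prime q∣ with euclidsLemma (suc n) (n !) q-prime q∣
... | inj₁ q∣1+n = ∣⇒≤ q∣1+n
... | inj₂ q∣n!  = m≤n⇒m≤1+n (prime∣n!⇒≤ n q-prime q∣n!)

prime∣∏⇒∣ : ∀ {q} t f → Prime q → q ∣ ∏ t f → ∃[ i ] 1≤ i ≤ t × q ∣ f i
prime∣∏⇒∣ zero    f q-prime q∣1 = contradiction (∣⇒≤ q∣1) (<⇒≱ (prime⇒2≤ q-prime))
prime∣∏⇒∣ (suc t) f q-prime q∣ with euclidsLemma (∏ t f) (f (suc t)) q-prime q∣
... | inj₁ q∣∏ with i , i∈ , q∣fi ← prime∣∏⇒∣ t f q-prime q∣∏ = i , 1≤-≤-suc i∈ , q∣fi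
... | inj₂ q∣f = suc t , 1≤suc≤suc t , q∣f

prime∤⇒coprime : ∀ {q m} → Prime q → ¬ q ∣ m → Coprime q m
prime∤⇒coprime q-prime q∤m (d∣q , d∣m) with prime⇒irreducible q-prime d∣q
... | inj₁ d≡1    = d≡1
... | inj₂ refl   = contradiction d∣m q∤m

*-∣-of-prime∤ : ∀ {q m n} → Prime q → ¬ q ∣ m → m ∣ n → q ∣ n → m * q ∣ n
*-∣-of-prime∤ {q} {m} q-prime q∤m (divides c refl) q∣cm
  with divides r refl ← coprime-divisor (prime∤⇒coprime q-prime q∤m) (subst (q ∣_) (*-comm c m) q∣cm) =
  divides r (trans (*-assoc r q m) (cong (r *_) (*-comm q m)))

primeOr1 : ℕ → ℕ
primeOr1 p = p ^ 𝟙 (prime? p)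

∣primeOr1⇒≤ : ∀ {q} p → 1 ≤ p → q ∣ primeOr1 p → q ≤ p
∣primeOr1⇒≤ p 1≤p q∣ with prime? p
... | yes _ = ∣⇒≤ {{>-nonZero 1≤p}} (subst (_ ∣_) (*-identityʳ p) q∣)
... | no _  = ≤-trans (∣⇒≤ q∣) 1≤p

∏primes∣ : ∀ a t {N} → (∀ i → 1≤ i ≤ t → Prime (a + i) → a + i ∣ N) → ∏ t (λ i → primeOr1 (a + i)) ∣ N
∏primes∣ a zero    h = 1∣ _
∏primes∣ a (suc t) {N} h with prime? (a + suc t) | ∏primes∣ a t (λ i r → h i (1≤-≤-suc r))
... | no _       | M∣N = subst (_∣ N) (sym (*-identityʳ _)) M∣N
... | yes q-prime | M∣N = subst (λ q′ → ∏ t (λ i → primeOr1 (a + i)) * q′ ∣ N) (sym (*-identityʳ q))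
      (*-∣-of-prime∤ q-prime q∤M M∣N (h (suc t) (1≤suc≤suc t) q-prime))
  where
  q : ℕ
  q = a + suc t
  q∤M : ¬ q ∣ ∏ t (λ i → primeOr1 (a + i))
  q∤M q∣M with i , (1≤i , i≤t) , q∣ ← prime∣∏⇒∣ t (λ i → primeOr1 (a + i)) q-prime q∣M =
    contradiction (∣primeOr1⇒≤ (a + i) (≤-trans 1≤i (m≤n+m i a)) q∣) (<⇒≱ (+-monoʳ-< a (s≤s i≤t)))

primorial : ℕ → ℕ
primorial n = ∏ n primeOr1

prime∣pascal : ∀ k q → Prime q → suc k < q → q ≤ suc (k + k) → q ∣ pascal k (suc k)
prime∣pascal k q q-prime k+1<q q≤2k+1
  with euclidsLemma (k ! * suc k !) (pascal k (suc k)) q-prime q∣factorials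
  where
  q∣factorials : q ∣ k ! * suc k ! * pascal k (suc k)
  q∣factorials = subst (q ∣_) (sym (trans (pascal-factorials k (suc k)) (cong _! (+-suc k k))))
                   (∣n! (prime⇒1≤ q-prime) q≤2k+1)
... | inj₂ q∣pascal = q∣pascal
... | inj₁ q∣k!*[k+1]! with euclidsLemma (k !) (suc k !) q-prime q∣k!*[k+1]!
...   | inj₁ q∣k!     = contradiction (prime∣n!⇒≤ k q-prime q∣k!) (<⇒≱ (≤-trans (n≤1+n (suc k)) k+1<q))
...   | inj₂ q∣[k+1]! = contradiction (prime∣n!⇒≤ (suc k) q-prime q∣[k+1]!) (<⇒≱ k+1<q)

primorial-odd : ∀ k → primorial (suc k + k) ≤ primorial (suc k) * 2 ^ (k + suc k)
primorial-odd k = begin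
  primorial (suc k + k)                                 ≡⟨ ∏-split (suc k) k primeOr1 ⟩
  primorial (suc k) * ∏ k (λ i → primeOr1 (suc k + i))  ≤⟨ *-monoʳ-≤ (primorial (suc k)) primes≤pascal ⟩
  primorial (suc k) * pascal k (suc k)                  ≤⟨ *-monoʳ-≤ (primorial (suc k)) (pascal≤2^ k (suc k)) ⟩
  primorial (suc k) * 2 ^ (k + suc k)                   ∎
  where
  open ≤-Reasoning
  primes≤pascal : ∏ k (λ i → primeOr1 (suc k + i)) ≤ pascal k (suc k)
  primes≤pascal = ∣⇒≤ {{>-nonZero (pascal≥1 k (suc k))}}
    (∏primes∣ (suc k) k (λ i (1≤i , i≤k) q-prime →
      prime∣pascal k (suc k + i) q-prime (m<m+n (suc k) 1≤i) (s≤s (+-monoʳ-≤ k i≤k))))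

even+2-not-prime : ∀ {k} → 1 ≤ k → ¬ Prime (suc (suc (k + k)))
even+2-not-prime {k} 1≤k p-prime with prime⇒irreducible p-prime (divides (suc k) (2k+2≡[k+1]*2 k))
  where
  2k+2≡[k+1]*2 : ∀ k → suc (suc (k + k)) ≡ suc k * 2
  2k+2≡[k+1]*2 = solve 1 (λ k → con 2 :+ (k :+ k) := (con 1 :+ k) :* con 2) refl
    where open +-*-Solver
... | inj₁ ()
... | inj₂ 2≡2k+2 = <⇒≢ (s≤s (s≤s (≤-trans 1≤k (m≤m+n k k)))) 2≡2k+2

primorial-even : ∀ {k} → 1 ≤ k → primorial (suc (suc (k + k))) ≡ primorial (suc (k + k))
primorial-even {k} 1≤k = trans (cong (λ e → primorial (suc (k + k)) * suc (suc (k + k)) ^ e) not-prime) (*-identityʳ _)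
  where
  not-prime : 𝟙 (prime? (suc (suc (k + k)))) ≡ 0
  not-prime = 𝟙-no (prime? (suc (suc (k + k)))) (even+2-not-prime 1≤k)

even⊎odd : ∀ n → ∃[ k ] (n ≡ k + k ⊎ n ≡ suc (k + k))
even⊎odd zero = 0 , inj₁ refl
even⊎odd (suc n) with even⊎odd n
... | k , inj₁ refl = k , inj₂ refl
... | k , inj₂ refl = suc k , inj₁ (cong suc (sym (+-suc k k)))

primorial≤8^ : ∀ n → primorial n ≤ 2 ^ (3 * n)
primorial≤8^ = <-rec (λ n → primorial n ≤ 2 ^ (3 * n)) step
  where
  open ≤-Reasoning
  step : ∀ n → (∀ {m} → m < n → primorial m ≤ 2 ^ (3 * m)) → primorial n ≤ 2 ^ (3 * n)
  step n rec with even⊎odd n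
  ... | zero , inj₁ refl = ≤-refl
  ... | suc zero , inj₁ refl = s≤s (s≤s z≤n)
  ... | suc (suc j) , inj₁ refl = begin
    primorial (suc (suc j) + suc (suc j))           ≡⟨ cong primorial 2k≡2+2j ⟩
    primorial (suc (suc (suc j + suc j)))           ≡⟨ primorial-even {suc j} (s≤s z≤n) ⟩
    primorial (suc (suc j + suc j))                 ≤⟨ rec {suc (suc j + suc j)} (≤-reflexive (sym 2k≡2+2j)) ⟩
    2 ^ (3 * suc (suc j + suc j))                   ≤⟨ ^-monoʳ-≤ 2 (*-monoʳ-≤ 3 (n≤1+n (suc (suc j + suc j)))) ⟩
    2 ^ (3 * suc (suc (suc j + suc j)))             ≡⟨ cong (λ m → 2 ^ (3 * m)) 2k≡2+2j ⟨
    2 ^ (3 * (suc (suc j) + suc (suc j)))           ∎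
    where
    2k≡2+2j : suc (suc j) + suc (suc j) ≡ suc (suc (suc j + suc j))
    2k≡2+2j = cong suc (+-suc (suc j) (suc j))
  ... | zero , inj₂ refl = s≤s z≤n
  ... | suc j , inj₂ refl = begin
    primorial (suc (suc j) + suc j)                 ≤⟨ primorial-odd (suc j) ⟩
    primorial (suc (suc j)) * 2 ^ (suc j + suc (suc j)) ≤⟨ *-monoˡ-≤ _ (rec {suc (suc j)} (s≤s (s≤s (m≤n+m (suc j) j)))) ⟩
    2 ^ (3 * suc (suc j)) * 2 ^ (suc j + suc (suc j)) ≡⟨ ^-distribˡ-+-* 2 (3 * suc (suc j)) (suc j + suc (suc j)) ⟨
    2 ^ e                                           ≤⟨ ^-monoʳ-≤ 2 (subst (e ≤_) (sym (exponents j)) (m≤m+n e j)) ⟩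
    2 ^ (3 * (suc (suc j) + suc j))                 ∎
    where
    e : ℕ
    e = 3 * suc (suc j) + (suc j + suc (suc j))
    exponents : ∀ j → 3 * (suc (suc j) + suc j) ≡ 3 * suc (suc j) + (suc j + suc (suc j)) + j
    exponents = solve 1 (λ j → con 3 :* ((con 2 :+ j) :+ (con 1 :+ j)) := con 3 :* (con 2 :+ j) :+ ((con 1 :+ j) :+ (con 2 :+ j)) :+ j) refl
      where open +-*-Solver

π : ℕ → ℕ
π y = ∑ y (λ p → 𝟙 (prime? p))

isqrt : ∀ y → 1 ≤ y → ∃[ r ] r * r < y × y ≤ suc r * suc r
isqrt (suc zero)     _ = 0 , s≤s z≤n , s≤s z≤n
isqrt (suc (suc y)) _ with r , r²<1+y , 1+y≤[1+r]² ← isqrt (suc y) (s≤s z≤n) with suc (suc y) ≤? suc r * suc r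
... | yes 2+y≤[1+r]² = r , m<n⇒m<1+n r²<1+y , 2+y≤[1+r]²
... | no 2+y≰[1+r]² = suc r , s≤s (≤-reflexive [1+r]²≡1+y) , 2+y≤[2+r]²
  where
  [1+r]²≡1+y : suc r * suc r ≡ suc y
  [1+r]²≡1+y = ≤-antisym (≤-pred (≰⇒> 2+y≰[1+r]²)) 1+y≤[1+r]²
  [2+r]²≡ : ∀ r → suc (suc r) * suc (suc r) ≡ suc (suc r * suc r + (r + suc (suc r)))
  [2+r]²≡ = solve 1 (λ r → (con 2 :+ r) :* (con 2 :+ r) := con 1 :+ ((con 1 :+ r) :* (con 1 :+ r) :+ (r :+ (con 2 :+ r)))) refl
    where open +-*-Solver
  2+y≤[2+r]² : suc (suc y) ≤ suc (suc r) * suc (suc r)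
  2+y≤[2+r]² = subst (λ t → suc t ≤ suc (suc r) * suc (suc r)) [1+r]²≡1+y
                 (subst (suc (suc r * suc r) ≤_) (sym ([2+r]²≡ r)) (s≤s (m≤m+n _ _)))

[1+r]²≤4^r : ∀ r → suc r * suc r ≤ 4 ^ r
[1+r]²≤4^r zero    = ≤-refl
[1+r]²≤4^r (suc r) = begin
  suc (suc r) * suc (suc r)                         ≤⟨ m≤m+n _ (3 * r * r + 4 * r) ⟩
  suc (suc r) * suc (suc r) + (3 * r * r + 4 * r)   ≡⟨ expand r ⟩
  4 * (suc r * suc r)                               ≤⟨ *-monoʳ-≤ 4 ([1+r]²≤4^r r) ⟩
  4 ^ suc r                                         ∎
  where
  open ≤-Reasoning
  expand : ∀ r → suc (suc r) * suc (suc r) + (3 * r * r + 4 * r) ≡ 4 * (suc r * suc r)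
  expand = solve 1 (λ r → (con 2 :+ r) :* (con 2 :+ r) :+ (con 3 :* r :* r :+ con 4 :* r) := con 4 :* ((con 1 :+ r) :* (con 1 :+ r))) refl
    where open +-*-Solver

∑𝟙≤≡⊓ : ∀ t r → ∑ t (λ p → 𝟙 (p ≤? r)) ≡ t ⊓ r
∑𝟙≤≡⊓ zero    r = refl
∑𝟙≤≡⊓ (suc t) r with suc t ≤? r
... | yes 1+t≤r = trans (cong (_+ 1) (trans (∑𝟙≤≡⊓ t r) (m≤n⇒m⊓n≡m (≤-trans (n≤1+n t) 1+t≤r))))
                    (trans (+-comm t 1) (sym (m≤n⇒m⊓n≡m 1+t≤r)))
... | no 1+t≰r = trans (+-identityʳ _)
                   (trans (∑𝟙≤≡⊓ t r) (trans (m≥n⇒m⊓n≡n r≤t) (sym (m≥n⇒m⊓n≡n (m≤n⇒m≤1+n r≤t)))))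
  where
  r≤t : r ≤ t
  r≤t = ≤-pred (≰⇒> 1+t≰r)

y^#[p²<y]≤2^2y : ∀ y → 1 ≤ y → y ^ ∑ y (λ p → 𝟙 (p * p <? y)) ≤ 2 ^ (2 * y)
y^#[p²<y]≤2^2y y 1≤y with r , r²<y , y≤[1+r]² ← isqrt y 1≤y = begin
  y ^ ∑ y (λ p → 𝟙 (p * p <? y)) ≤⟨ ^-monoʳ-≤ y {{>-nonZero 1≤y}} count≤r ⟩
  y ^ r                          ≤⟨ ^-monoˡ-≤ r (≤-trans y≤[1+r]² ([1+r]²≤4^r r)) ⟩
  (4 ^ r) ^ r                    ≡⟨ ^-*-assoc 4 r r ⟩
  4 ^ (r * r)                    ≤⟨ ^-monoʳ-≤ 4 (<⇒≤ r²<y) ⟩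
  4 ^ y                          ≡⟨ ^-*-assoc 2 2 y ⟩
  2 ^ (2 * y)                    ∎
  where
  open ≤-Reasoning
  p²<y⇒p≤r : ∀ {p} → p * p < y → p ≤ r
  p²<y⇒p≤r {p} p²<y with p ≤? r
  ... | yes p≤r = p≤r
  ... | no p≰r  = contradiction (≤-trans y≤[1+r]² (*-mono-≤ (≰⇒> p≰r) (≰⇒> p≰r))) (<⇒≱ p²<y)
  count≤r : ∑ y (λ p → 𝟙 (p * p <? y)) ≤ r
  count≤r = begin
    ∑ y (λ p → 𝟙 (p * p <? y)) ≤⟨ ∑-mono-≤ y (λ p _ → 𝟙-mono (p * p <? y) (p ≤? r) p²<y⇒p≤r) ⟩
    ∑ y (λ p → 𝟙 (p ≤? r))     ≡⟨ ∑𝟙≤≡⊓ y r ⟩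
    y ⊓ r                      ≤⟨ m⊓n≤n y r ⟩
    r                          ∎

-- A prime p ≤ y has either p * p < y, which holds for at most √y values of p, or
-- y ≤ p * p; hence y ^ π y ≤ y ^ √y * primorial y ^ 2.
y^π≤2^8y : ∀ y → y ^ π y ≤ 2 ^ (8 * y)
y^π≤2^8y zero = ≤-refl
y^π≤2^8y y@(suc _) = begin
  y ^ π y                                                       ≡⟨ ∏-^ y y (λ p → 𝟙 (prime? p)) ⟨
  ∏ y (λ p → y ^ 𝟙 (prime? p))                                  ≤⟨ ∏-mono-≤ y small-or-square ⟩
  ∏ y (λ p → y ^ 𝟙 (p * p <? y) * (primeOr1 p * primeOr1 p))    ≡⟨ ∏-distrib y _ _ ⟩
  ∏ y (λ p → y ^ 𝟙 (p * p <? y)) * ∏ y (λ p → primeOr1 p * primeOr1 p)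
                                                                ≡⟨ cong₂ _*_ (∏-^ y y _) (∏-distrib y primeOr1 primeOr1) ⟩
  y ^ ∑ y (λ p → 𝟙 (p * p <? y)) * (primorial y * primorial y)  ≤⟨ *-mono-≤ (y^#[p²<y]≤2^2y y (s≤s z≤n))
                                                                      (*-mono-≤ (primorial≤8^ y) (primorial≤8^ y)) ⟩
  2 ^ (2 * y) * (2 ^ (3 * y) * 2 ^ (3 * y))                     ≡⟨ cong (2 ^ (2 * y) *_) (^-distribˡ-+-* 2 (3 * y) (3 * y)) ⟨
  2 ^ (2 * y) * 2 ^ (3 * y + 3 * y)                             ≡⟨ ^-distribˡ-+-* 2 (2 * y) _ ⟨
  2 ^ (2 * y + (3 * y + 3 * y))                                 ≡⟨ cong (2 ^_) (exponents y) ⟩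
  2 ^ (8 * y)                                                   ∎
  where
  open ≤-Reasoning
  exponents : ∀ y → 2 * y + (3 * y + 3 * y) ≡ 8 * y
  exponents = solve 1 (λ y → con 2 :* y :+ (con 3 :* y :+ con 3 :* y) := con 8 :* y) refl
    where open +-*-Solver
  small-or-square : ∀ p → 1≤ p ≤ y → y ^ 𝟙 (prime? p) ≤ y ^ 𝟙 (p * p <? y) * (primeOr1 p * primeOr1 p)
  small-or-square p (1≤p , _) with prime? p | p * p <? y
  ... | no _  | d     = subst (1 ≤_) (sym (*-identityʳ _)) (m^n>0 y (𝟙 d))
  ... | yes _ | yes _ = m≤m*n (y * 1) (p * 1 * (p * 1)) {{>-nonZero (*-mono-≤ 1≤p*1 1≤p*1)}}
    where
    1≤p*1 : 1 ≤ p * 1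
    1≤p*1 = subst (1 ≤_) (sym (*-identityʳ p)) 1≤p
  ... | yes _ | no p²≮y = subst₂ _≤_ (sym (*-identityʳ y))
                            (sym (trans (*-identityˡ _) (cong₂ _*_ (*-identityʳ p) (*-identityʳ p)))) (≮⇒≥ p²≮y)

-- The smooth numbers in (x / y, x]

n<2^n : ∀ n → n < 2 ^ n
n<2^n zero    = s≤s z≤n
n<2^n (suc n) = begin-strict
  suc n         <⟨ s≤s (n<2^n n) ⟩
  suc (2 ^ n)   ≤⟨ +-monoˡ-≤ (2 ^ n) (m^n>0 2 n) ⟩
  2 ^ n + 2 ^ n ≡⟨ cong (2 ^ n +_) (+-identityʳ (2 ^ n)) ⟨
  2 ^ suc n     ∎
  where open ≤-Reasoning

-- ν x p n counts the j ∈ [1, x] with p ^ j ∣ n; for p ≥ 2 and 1 ≤ n ≤ x it is the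
-- exponent of p in n.
ν : ℕ → ℕ → ℕ → ℕ
ν x p n = ∑ x (λ j → 𝟙 (p ^ j ∣? n))

ν-mono-∣ : ∀ x p {a b} → a ∣ b → ν x p a ≤ ν x p b
ν-mono-∣ x p a∣b = ∑-mono-≤ x (λ j _ → 𝟙-mono (p ^ j ∣? _) (p ^ j ∣? _) (λ pʲ∣a → ∣-trans pʲ∣a a∣b))

ν-*-self : ∀ x {q N} → 2 ≤ q → 1 ≤ N → q * N ≤ x → suc (ν x q N) ≤ ν x q (q * N)
ν-*-self zero    {q} {N} 2≤q 1≤N qN≤0 = contradiction (≤-trans (*-mono-≤ (≤-trans (s≤s z≤n) 2≤q) 1≤N) qN≤0) (λ ())
ν-*-self (suc x) {q} {N} 2≤q 1≤N qN≤x = begin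
  suc (ν (suc x) q N)                ≡⟨ cong suc (trans (cong (ν x q N +_) top-absent) (+-identityʳ _)) ⟩
  suc (ν x q N)                      ≤⟨ s≤s (∑-mono-≤ x (λ j _ → 𝟙-mono (q ^ j ∣? N) (q ^ suc j ∣? (q * N)) (*-monoʳ-∣ q))) ⟩
  suc (∑ x (λ j → F (suc j)))        ≡⟨ cong (_+ ∑ x (λ j → F (suc j))) (𝟙-yes (q ^ 1 ∣? (q * N)) (*-monoʳ-∣ q (1∣ N))) ⟨
  F 1 + ∑ x (λ j → F (suc j))        ≡⟨ ∑-split 1 x F ⟨
  ν (suc x) q (q * N)                ∎
  where
  open ≤-Reasoning
  F : ℕ → ℕ
  F j = 𝟙 (q ^ j ∣? (q * N))
  top-absent : 𝟙 (q ^ suc x ∣? N) ≡ 0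
  top-absent = 𝟙-no (q ^ suc x ∣? N) λ q^[1+x]∣N →
    <⇒≱ (≤-trans (n<2^n (suc x)) (^-monoˡ-≤ (suc x) 2≤q))
        (≤-trans (∣⇒≤ {{>-nonZero 1≤N}} q^[1+x]∣N) (≤-trans (m≤n*m N q {{>-nonZero (≤-trans (s≤s z≤n) 2≤q)}}) qN≤x))

∏-^𝟙≟ : ∀ y q → 1≤ q ≤ y → ∏ y (λ p → p ^ 𝟙 (p ≟ q)) ≡ q
∏-^𝟙≟ zero    q (1≤q , q≤0) = contradiction (≤-trans 1≤q q≤0) (λ ())
∏-^𝟙≟ (suc y) q (1≤q , q≤1+y) with suc y ≟ q
... | yes refl = trans (cong (_* (suc y * 1)) (∏-one y below)) (trans (+-identityʳ _) (*-identityʳ _))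
  where
  below : ∀ p → 1≤ p ≤ y → p ^ 𝟙 (p ≟ suc y) ≡ 1
  below p (_ , p≤y) = cong (p ^_) (𝟙-no (p ≟ suc y) λ { refl → <-irrefl refl p≤y })
... | no 1+y≢q = trans (*-identityʳ _) (∏-^𝟙≟ y q (1≤q , ≤-pred (≤∧≢⇒< q≤1+y (λ q≡1+y → 1+y≢q (sym q≡1+y)))))

smoothPart : ℕ → ℕ → ℕ → ℕ
smoothPart x y n = ∏ y (λ p → p ^ (𝟙 (prime? p) * ν x p n))

smoothPart-*prime : ∀ x y {q N} → Prime q → q ≤ y → 1 ≤ N → q * N ≤ x → smoothPart x y N * q ≤ smoothPart x y (q * N)
smoothPart-*prime x y {q} {N} q-prime q≤y 1≤N qN≤x = begin
  smoothPart x y N * q                                                 ≡⟨ cong (smoothPart x y N *_) (∏-^𝟙≟ y q (prime⇒1≤ q-prime , q≤y)) ⟨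
  smoothPart x y N * ∏ y (λ p → p ^ 𝟙 (p ≟ q))                         ≡⟨ ∏-distrib y _ _ ⟨
  ∏ y (λ p → p ^ (𝟙 (prime? p) * ν x p N) * p ^ 𝟙 (p ≟ q))             ≤⟨ ∏-mono-≤ y pointwise ⟩
  smoothPart x y (q * N)                                               ∎
  where
  open ≤-Reasoning
  pointwise : ∀ p → 1≤ p ≤ y → p ^ (𝟙 (prime? p) * ν x p N) * p ^ 𝟙 (p ≟ q) ≤ p ^ (𝟙 (prime? p) * ν x p (q * N))
  pointwise p (1≤p , _) with p ≟ q
  ... | yes refl = begin
    p ^ (𝟙 (prime? p) * ν x p N) * (p * 1)   ≡⟨ cong (λ t → p ^ (t * ν x p N) * (p * 1)) (𝟙-yes (prime? p) q-prime) ⟩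
    p ^ (1 * ν x p N) * (p * 1)              ≡⟨ ^-distribˡ-+-* p (1 * ν x p N) 1 ⟨
    p ^ (1 * ν x p N + 1)                    ≤⟨ ^-monoʳ-≤ p {{>-nonZero 1≤p}} (subst₂ _≤_ (trans (+-comm 1 _) (cong (_+ 1) (sym (*-identityˡ _))))
                                                  (sym (*-identityˡ _)) (ν-*-self x (prime⇒2≤ q-prime) 1≤N qN≤x)) ⟩
    p ^ (1 * ν x p (p * N))                  ≡⟨ cong (λ t → p ^ (t * ν x p (p * N))) (𝟙-yes (prime? p) q-prime) ⟨
    p ^ (𝟙 (prime? p) * ν x p (p * N))       ∎
  ... | no _ = subst (_≤ p ^ (𝟙 (prime? p) * ν x p (q * N))) (sym (*-identityʳ _))
                 (^-monoʳ-≤ p {{>-nonZero 1≤p}} (*-monoʳ-≤ (𝟙 (prime? p)) (ν-mono-∣ x p (n∣m*n q))))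

≤smoothPart : ∀ x y n → 1 ≤ n → n ≤ x → AllPrimeFactors≤ y n → n ≤ smoothPart x y n
≤smoothPart x y n 1≤n n≤x h with ps , refl , ps≤y ← smoothFactorisation n 1≤n h = product≤ ps ps≤y n≤x
  where
  product≤ : ∀ ps → All (λ p → Prime p × p ≤ y) ps → product ps ≤ x → product ps ≤ smoothPart x y (product ps)
  product≤ [] [] _ = subst (_≤ smoothPart x y 1) (∏-one y (λ _ _ → refl))
    (∏-mono-≤ y (λ p (1≤p , _) → m^n>0 p {{>-nonZero 1≤p}} (𝟙 (prime? p) * ν x p 1)))
  product≤ (q ∷ ps) ((q-prime , q≤y) ∷ ps≤y) qN≤x = begin
    q * product ps                      ≤⟨ *-monoʳ-≤ q (product≤ ps ps≤y N≤x) ⟩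
    q * smoothPart x y (product ps)     ≡⟨ *-comm q _ ⟩
    smoothPart x y (product ps) * q     ≤⟨ smoothPart-*prime x y q-prime q≤y (productOfPrimes≥1 (All.map proj₁ ps≤y)) qN≤x ⟩
    smoothPart x y (q * product ps)     ∎
    where
    open ≤-Reasoning
    N≤x : product ps ≤ x
    N≤x = ≤-trans (m≤n*m (product ps) q {{>-nonZero (prime⇒1≤ q-prime)}}) qN≤x

module GeometricProgression (x y p : ℕ) (f : ℕ → ℕ) (1≤p : 1 ≤ p) (f-suc : ∀ j → f (suc j) ≡ p * f j) where

  instance
    _ : NonZero p
    _ = >-nonZero 1≤p

  f-mono : ∀ {j k} → j ≤ k → f j ≤ f k
  f-mono {j} j≤k with d , refl ← m≤n⇒∃[o]m+o≡n j≤k = go d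
    where
    go : ∀ d → f j ≤ f (j + d)
    go zero    = ≤-reflexive (cong f (sym (+-identityʳ j)))
    go (suc d) = ≤-trans (go d) (subst (f (j + d) ≤_) (trans (sym (f-suc (j + d))) (cong f (sym (+-suc j d)))) (m≤n*m (f (j + d)) p))

  hits : ℕ → ℕ
  hits t = ∑ t (λ j → 𝟙 (inWindow? x y (f j)))

  -- j is the last hit: a new hit multiplies the left side by p and moves j
  -- forward, which multiplies the right side by at least p.
  hits-invariant : ∀ t → hits t ≡ 0 ⊎ ∃[ j ] j ≤ t × f j ≤ x × p ^ hits t * x < f (suc j) * y
  hits-invariant zero = inj₁ refl
  hits-invariant (suc t) with inWindow? x y (f (suc t)) | hits-invariant t
  ... | no _ | inj₁ none = inj₁ (trans (+-identityʳ _) none)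
  ... | no _ | inj₂ (j , j≤t , fj≤x , below) =
    inj₂ (j , m≤n⇒m≤1+n j≤t , fj≤x , subst (λ c → p ^ c * x < f (suc j) * y) (sym (+-identityʳ (hits t))) below)
  ... | yes (f≤x , x<fy) | inj₁ none = inj₂ (suc t , ≤-refl , f≤x , (begin-strict
    p ^ (hits t + 1) * x      ≡⟨ cong (λ c → p ^ (c + 1) * x) none ⟩
    p * 1 * x                 ≡⟨ cong (_* x) (*-identityʳ p) ⟩
    p * x                     <⟨ *-monoʳ-< p x<fy ⟩
    p * (f (suc t) * y)       ≡⟨ *-assoc p _ y ⟨
    p * f (suc t) * y         ≡⟨ cong (_* y) (f-suc (suc t)) ⟨
    f (suc (suc t)) * y       ∎))
    where open ≤-Reasoning
  ... | yes (f≤x , x<fy) | inj₂ (j , j≤t , fj≤x , below) = inj₂ (suc t , ≤-refl , f≤x , (begin-strict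
    p ^ (hits t + 1) * x      ≡⟨ cong (λ c → p ^ c * x) (+-comm (hits t) 1) ⟩
    p * p ^ hits t * x        ≡⟨ *-assoc p _ x ⟩
    p * (p ^ hits t * x)      <⟨ *-monoʳ-< p below ⟩
    p * (f (suc j) * y)       ≡⟨ *-assoc p _ y ⟨
    p * f (suc j) * y         ≡⟨ cong (_* y) (f-suc (suc j)) ⟨
    f (suc (suc j)) * y       ≤⟨ *-monoˡ-≤ y (f-mono (s≤s (s≤s j≤t))) ⟩
    f (suc (suc t)) * y       ∎))
    where open ≤-Reasoning

  p^hits≤p*y : ∀ t → 1 ≤ y → p ^ hits t ≤ p * y
  p^hits≤p*y t 1≤y with hits-invariant t
  ... | inj₁ none = subst (_≤ p * y) (cong (p ^_) (sym none)) (*-mono-≤ 1≤p 1≤y)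
  ... | inj₂ (j , _ , fj≤x , below) = <⇒≤ (*-cancelʳ-< x (p ^ hits t) (p * y) (begin-strict
    p ^ hits t * x            <⟨ below ⟩
    f (suc j) * y             ≡⟨ cong (_* y) (f-suc j) ⟩
    p * f j * y               ≤⟨ *-monoˡ-≤ y (*-monoʳ-≤ p fj≤x) ⟩
    p * x * y                 ≡⟨ xy∙z≈xz∙y p x y ⟩
    p * y * x                 ∎))
    where open ≤-Reasoning

layerHits : ℕ → ℕ → ℕ → ℕ → ℕ
layerHits x y p m = ∑ x (λ j → 𝟙 (layer? x y (m * p ^ j)))

p^layerHits≤y² : ∀ x y p m → Prime p → p ≤ y → p ^ layerHits x y p m ≤ y * y
p^layerHits≤y² x y p m p-prime p≤y = begin
  p ^ layerHits x y p m                        ≤⟨ ^-monoʳ-≤ p {{>-nonZero 1≤p}} (∑-mono-≤ x (λ j _ →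
                                                    𝟙-mono (layer? x y (m * p ^ j)) (inWindow? x y (m * p ^ j)) proj₂)) ⟩
  p ^ GeometricProgression.hits x y p f 1≤p f-suc x ≤⟨ GeometricProgression.p^hits≤p*y x y p f 1≤p f-suc x (≤-trans 1≤p p≤y) ⟩
  p * y                                        ≤⟨ *-monoˡ-≤ y p≤y ⟩
  y * y                                        ∎
  where
  open ≤-Reasoning
  1≤p : 1 ≤ p
  1≤p = prime⇒1≤ p-prime
  f : ℕ → ℕ
  f j = m * p ^ j
  f-suc : ∀ j → f (suc j) ≡ p * f j
  f-suc j = x∙yz≈y∙xz m p (p ^ j)

∑layer-ν≤∑smooth-layerHits : ∀ x y p → 1 ≤ p →
  ∑ x (λ n → 𝟙 (layer? x y n) * ν x p n) ≤ ∑ x (λ m → 𝟙 (smooth? y m) * layerHits x y p m)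
∑layer-ν≤∑smooth-layerHits x y p 1≤p = begin
  ∑ x (λ n → 𝟙 (layer? x y n) * ν x p n)                          ≡⟨ ∑-cong x (λ n _ → *-distribˡ-∑ (𝟙 (layer? x y n)) x _) ⟩
  ∑ x (λ n → ∑ x (λ j → 𝟙 (layer? x y n) * 𝟙 (p ^ j ∣? n)))       ≡⟨ ∑-comm x x _ ⟩
  ∑ x (λ j → ∑ x (λ n → 𝟙 (layer? x y n) * 𝟙 (p ^ j ∣? n)))       ≤⟨ ∑-mono-≤ x (λ j _ → multiples j) ⟩
  ∑ x (λ j → ∑ x (λ m → 𝟙 (smooth? y m) * 𝟙 (layer? x y (m * p ^ j)))) ≡⟨ ∑-comm x x _ ⟨
  ∑ x (λ m → ∑ x (λ j → 𝟙 (smooth? y m) * 𝟙 (layer? x y (m * p ^ j)))) ≡⟨ ∑-cong x (λ m _ → *-distribˡ-∑ (𝟙 (smooth? y m)) x _) ⟨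
  ∑ x (λ m → 𝟙 (smooth? y m) * layerHits x y p m)                 ∎
  where
  open ≤-Reasoning
  cofactor-smooth : ∀ d m → 1 ≤ d → 1≤ m ≤ x → 𝟙 (layer? x y (m * d)) ≤ 𝟙 (smooth? y m) * 𝟙 (layer? x y (m * d))
  cofactor-smooth d m 1≤d (1≤m , _) with layer? x y (m * d)
  ... | no _ = z≤n
  ... | yes (smd , _) = ≤-reflexive (sym (cong (_* 1) (𝟙-yes (smooth? y m) (smooth-∣ (*-mono-≤ 1≤m 1≤d) (m∣m*n d) smd))))
  multiples : ∀ j → ∑ x (λ n → 𝟙 (layer? x y n) * 𝟙 (p ^ j ∣? n)) ≤ ∑ x (λ m → 𝟙 (smooth? y m) * 𝟙 (layer? x y (m * p ^ j)))
  multiples j = begin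
    ∑ x (λ n → 𝟙 (layer? x y n) * 𝟙 (p ^ j ∣? n))   ≡⟨ ∑-cong x (λ n _ → *-comm (𝟙 (layer? x y n)) _) ⟩
    ∑ x (λ n → 𝟙 (p ^ j ∣? n) * 𝟙 (layer? x y n))   ≤⟨ ∑-multiples-≤ (p ^ j) x (λ n → 𝟙 (layer? x y n)) 1≤pʲ ⟩
    ∑ x (λ m → 𝟙 (layer? x y (m * p ^ j)))          ≤⟨ ∑-mono-≤ x (λ m r → cofactor-smooth (p ^ j) m 1≤pʲ r) ⟩
    ∑ x (λ m → 𝟙 (smooth? y m) * 𝟙 (layer? x y (m * p ^ j))) ∎
    where
    1≤pʲ : 1 ≤ p ^ j
    1≤pʲ = m^n>0 p {{>-nonZero 1≤p}} j

p^ν-layer≤ : ∀ x y p → 1≤ p ≤ y →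
  p ^ (𝟙 (prime? p) * ∑ x (λ n → 𝟙 (layer? x y n) * ν x p n)) ≤ (y * y) ^ (𝟙 (prime? p) * Ψ x y)
p^ν-layer≤ x y p (1≤p , p≤y) with prime? p
... | no _        = ≤-refl
... | yes p-prime = begin
  p ^ (1 * ∑ x (λ n → 𝟙 (layer? x y n) * ν x p n))     ≡⟨ cong (p ^_) (*-identityˡ (∑ x (λ n → 𝟙 (layer? x y n) * ν x p n))) ⟩
  p ^ ∑ x (λ n → 𝟙 (layer? x y n) * ν x p n)           ≤⟨ ^-monoʳ-≤ p {{>-nonZero 1≤p}} (∑layer-ν≤∑smooth-layerHits x y p 1≤p) ⟩
  p ^ ∑ x (λ m → 𝟙 (smooth? y m) * layerHits x y p m)  ≡⟨ ∏-^ p x _ ⟨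
  ∏ x (λ m → p ^ (𝟙 (smooth? y m) * layerHits x y p m)) ≤⟨ ∏-mono-≤ x (λ m _ → per-cofactor m) ⟩
  ∏ x (λ m → (y * y) ^ 𝟙 (smooth? y m))                 ≡⟨ ∏-^ (y * y) x _ ⟩
  (y * y) ^ ∑ x (λ m → 𝟙 (smooth? y m))                 ≡⟨ cong (λ k → (y * y) ^ k) (trans (sym (Ψ≡∑smooth x y)) (sym (*-identityˡ _))) ⟩
  (y * y) ^ (1 * Ψ x y)                                 ∎
  where
  open ≤-Reasoning
  per-cofactor : ∀ m → p ^ (𝟙 (smooth? y m) * layerHits x y p m) ≤ (y * y) ^ 𝟙 (smooth? y m)
  per-cofactor m with smooth? y m
  ... | no _  = ≤-refl
  ... | yes _ = subst₂ _≤_ (cong (p ^_) (sym (+-identityʳ (layerHits x y p m)))) (sym (*-identityʳ (y * y))) (p^layerHits≤y² x y p m p-prime p≤y)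

∏layer≤ : ∀ x y → ∏ x (λ n → n ^ 𝟙 (layer? x y n)) ≤ (y * y) ^ (π y * Ψ x y)
∏layer≤ x y = begin
  ∏ x (λ n → n ^ e n)                                          ≤⟨ ∏-mono-≤ x layer≤smoothPart ⟩
  ∏ x (λ n → ∏ y (λ p → p ^ (e n * (c p * ν x p n))))          ≡⟨ ∏-comm x y _ ⟩
  ∏ y (λ p → ∏ x (λ n → p ^ (e n * (c p * ν x p n))))          ≡⟨ ∏-cong y (λ p _ → ∏-^ p x _) ⟩
  ∏ y (λ p → p ^ ∑ x (λ n → e n * (c p * ν x p n)))            ≡⟨ ∏-cong y (λ p _ → cong (p ^_) (pull-out (c p))) ⟩
  ∏ y (λ p → p ^ (c p * ∑ x (λ n → e n * ν x p n)))            ≤⟨ ∏-mono-≤ y (p^ν-layer≤ x y) ⟩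
  ∏ y (λ p → (y * y) ^ (c p * Ψ x y))                          ≡⟨ ∏-^ (y * y) y _ ⟩
  (y * y) ^ ∑ y (λ p → c p * Ψ x y)                            ≡⟨ cong ((y * y) ^_) (∑-*ʳ y (Ψ x y)) ⟩
  (y * y) ^ (π y * Ψ x y)                                      ∎
  where
  open ≤-Reasoning
  e : ℕ → ℕ
  e n = 𝟙 (layer? x y n)
  c : ℕ → ℕ
  c p = 𝟙 (prime? p)
  layer≤smoothPart : ∀ n → 1≤ n ≤ x → n ^ e n ≤ ∏ y (λ p → p ^ (e n * (c p * ν x p n)))
  layer≤smoothPart n (1≤n , n≤x) with layer? x y n
  ... | yes (sn , _) = subst₂ _≤_ (sym (*-identityʳ n)) (∏-cong y (λ p _ → cong (p ^_) (sym (+-identityʳ (c p * ν x p n)))))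
                         (≤smoothPart x y n 1≤n n≤x (smooth⇒allPrimeFactors≤ 1≤n sn))
  ... | no _ = ≤-reflexive (sym (∏-one y {λ p → p ^ (0 * (c p * ν x p n))} (λ _ _ → refl)))
  pull-out : ∀ k {f : ℕ → ℕ} → ∑ x (λ n → e n * (k * f n)) ≡ k * ∑ x (λ n → e n * f n)
  pull-out k {f} = trans (∑-cong x (λ n _ → x∙yz≈y∙xz (e n) k (f n))) (sym (*-distribˡ-∑ k x _))
  ∑-*ʳ : ∀ t N → ∑ t (λ p → c p * N) ≡ π t * N
  ∑-*ʳ t N = trans (∑-cong t (λ p _ → *-comm (c p) N)) (trans (sym (*-distribˡ-∑ N t c)) (*-comm N (π t)))

x^#layer≤ : ∀ x y → x ^ #layer x y ≤ ∏ x (λ n → n ^ 𝟙 (layer? x y n)) * y ^ #layer x y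
x^#layer≤ x y = begin
  x ^ #layer x y                                   ≡⟨ ∏-^ x x e ⟨
  ∏ x (λ n → x ^ e n)                              ≤⟨ ∏-mono-≤ x (λ n _ → below-n*y n) ⟩
  ∏ x (λ n → n ^ e n * y ^ e n)                    ≡⟨ ∏-distrib x _ _ ⟩
  ∏ x (λ n → n ^ e n) * ∏ x (λ n → y ^ e n)        ≡⟨ cong (∏ x (λ n → n ^ e n) *_) (∏-^ y x e) ⟩
  ∏ x (λ n → n ^ e n) * y ^ #layer x y             ∎
  where
  open ≤-Reasoning
  e : ℕ → ℕ
  e n = 𝟙 (layer? x y n)
  below-n*y : ∀ n → x ^ e n ≤ n ^ e n * y ^ e n
  below-n*y n with layer? x y n
  ... | yes (_ , _ , x<ny) = subst₂ _≤_ (sym (*-identityʳ x)) (sym (cong₂ _*_ (*-identityʳ n) (*-identityʳ y))) (<⇒≤ x<ny)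
  ... | no _ = ≤-refl

2^-cancel-≤ : ∀ {a b} → 2 ^ a ≤ 2 ^ b → a ≤ b
2^-cancel-≤ {a} {b} 2^a≤2^b with a ≤? b
... | yes a≤b = a≤b
... | no a≰b  = contradiction 2^a≤2^b (<⇒≱ (^-monoʳ-< 2 (s≤s (s≤s z≤n)) (≰⇒> a≰b)))

^-distribʳ-* : ∀ a b n → (a * b) ^ n ≡ a ^ n * b ^ n
^-distribʳ-* a b zero    = refl
^-distribʳ-* a b (suc n) = trans (cong ((a * b) *_) (^-distribʳ-* a b n)) (*-interchange a b (a ^ n) (b ^ n))

[y*y]^[πΨ]≤2^16yΨ : ∀ y Ψ′ → (y * y) ^ (π y * Ψ′) ≤ 2 ^ (16 * y * Ψ′)
[y*y]^[πΨ]≤2^16yΨ y Ψ′ = begin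
  (y * y) ^ (π y * Ψ′)              ≡⟨ ^-*-assoc (y * y) (π y) Ψ′ ⟨
  ((y * y) ^ π y) ^ Ψ′              ≡⟨ cong (_^ Ψ′) (^-distribʳ-* y y (π y)) ⟩
  (y ^ π y * y ^ π y) ^ Ψ′          ≤⟨ ^-monoˡ-≤ Ψ′ (*-mono-≤ (y^π≤2^8y y) (y^π≤2^8y y)) ⟩
  (2 ^ (8 * y) * 2 ^ (8 * y)) ^ Ψ′  ≡⟨ cong (_^ Ψ′) (^-distribˡ-+-* 2 (8 * y) (8 * y)) ⟨
  (2 ^ (8 * y + 8 * y)) ^ Ψ′        ≡⟨ cong (λ t → (2 ^ t) ^ Ψ′) (exponents y) ⟩
  (2 ^ (16 * y)) ^ Ψ′               ≡⟨ ^-*-assoc 2 (16 * y) Ψ′ ⟩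
  2 ^ (16 * y * Ψ′)                 ∎
  where
  open ≤-Reasoning
  exponents : ∀ y → 8 * y + 8 * y ≡ 16 * y
  exponents = solve 1 (λ y → con 8 :* y :+ con 8 :* y := con 16 :* y) refl
    where open +-*-Solver

#layer-bound : ∀ m x y → 1 ≤ y → 2 ^ ((16 * suc m + 1) * y) ≤ x → suc m * #layer x y ≤ Ψ x y
#layer-bound m x y 1≤y 2^Ky≤x =
  *-cancelʳ-≤ (suc m * L) (Ψ x y) (16 * y) {{>-nonZero (*-mono-≤ {1} {16} (s≤s z≤n) 1≤y)}}
    (+-cancelʳ-≤ (y * L) _ _ (subst₂ _≤_ (lhs m y L) (rhs y (Ψ x y) L) (2^-cancel-≤ powers)))
  where
  L : ℕ
  L = #layer x y
  open ≤-Reasoning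
  powers : 2 ^ ((16 * suc m + 1) * y * L) ≤ 2 ^ (16 * y * Ψ x y + y * L)
  powers = begin
    2 ^ ((16 * suc m + 1) * y * L)                          ≡⟨ ^-*-assoc 2 ((16 * suc m + 1) * y) L ⟨
    (2 ^ ((16 * suc m + 1) * y)) ^ L                        ≤⟨ ^-monoˡ-≤ L 2^Ky≤x ⟩
    x ^ L                                                   ≤⟨ x^#layer≤ x y ⟩
    ∏ x (λ n → n ^ 𝟙 (layer? x y n)) * y ^ L                ≤⟨ *-monoˡ-≤ (y ^ L) (∏layer≤ x y) ⟩
    (y * y) ^ (π y * Ψ x y) * y ^ L                         ≤⟨ *-mono-≤ ([y*y]^[πΨ]≤2^16yΨ y (Ψ x y)) (^-monoˡ-≤ L (<⇒≤ (n<2^n y))) ⟩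
    2 ^ (16 * y * Ψ x y) * (2 ^ y) ^ L                      ≡⟨ cong (2 ^ (16 * y * Ψ x y) *_) (^-*-assoc 2 y L) ⟩
    2 ^ (16 * y * Ψ x y) * 2 ^ (y * L)                      ≡⟨ ^-distribˡ-+-* 2 (16 * y * Ψ x y) (y * L) ⟨
    2 ^ (16 * y * Ψ x y + y * L)                            ∎
  open +-*-Solver
  lhs : ∀ m y L → (16 * suc m + 1) * y * L ≡ suc m * L * (16 * y) + y * L
  lhs = solve 3 (λ m y L → (con 16 :* (con 1 :+ m) :+ con 1) :* y :* L := (con 1 :+ m) :* L :* (con 16 :* y) :+ y :* L) refl
  rhs : ∀ y P L → 16 * y * P + y * L ≡ P * (16 * y) + y * L
  rhs = solve 3 (λ y P L → con 16 :* y :* P :+ y :* L := P :* (con 16 :* y) :+ y :* L) refl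

theorem1p1 : (m : ℕ) → ∃[ K ] ∃[ Y ] ((x y : ℕ) → Y ≤ y → 2 ^ (K * y) ≤ x →
               suc m * ∣ A x y - Ψ x y ∣ ≤ Ψ x y)
theorem1p1 m = 16 * suc m + 1 , 1 , λ x y 1≤y 2^Ky≤x → begin
  suc m * ∣ A x y - Ψ x y ∣ ≡⟨ cong (suc m *_) (m≤n⇒∣m-n∣≡n∸m (A≤Ψ x y)) ⟩
  suc m * (Ψ x y ∸ A x y)   ≤⟨ *-monoʳ-≤ (suc m) (m≤n+o⇒m∸n≤o (Ψ x y) (A x y) (Ψ≤A+#layer x y 1≤y)) ⟩
  suc m * #layer x y        ≤⟨ #layer-bound m x y 1≤y 2^Ky≤x ⟩
  Ψ x y                     ∎
  where open ≤-Reasoning
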